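{- Let $G$ and $H$ be nontrivial, connected graphs such that $G$ has no isolatable vertex. If $G \times H$ is well-covered, then $G$ is a regular graph of degree $\frac{n(G)}{\alpha(G)}-1$.
   Context: Graphs are finite and simple; nontrivial means having at least two vertices. The direct product $G\times H$ has vertex set $V(G)\times V(H)$, with $(g_1,h_1)(g_2,h_2)$ an edge iff $g_1g_2\in E(G)$ and $h_1h_2\in E(H)$. A graph is well-covered if all of its maximal independent sets have the same cardinality. A vertex $x$ of $G$ is isolatable if there exists an independent set $I$ of $G$ such that $x$ is an isolated vertex of $G-N[I]$ ($I$ may be empty). $\alpha(G)$ is the independence number and $n(G)$ the order. -}

module Defs where

open import Data.Nat using (ℕ; suc; _*_; _≤_)
open import Data.Bool using (Bool; true; false; _∧_)
open import Data.Fin using (Fin; remQuot)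
open import Data.Fin.Subset using (Subset; _∈_; _∉_; _⊆_; ∣_∣)
open import Data.Vec using (tabulate)
open import Data.Product using (Σ; _×_; _,_; ∃; proj₁; proj₂)
open import Relation.Binary.PropositionalEquality using (_≡_; refl; cong₂)
open import Relation.Nullary using (¬_)
open import Data.Sum using (_⊎_)

record Graph : Set where
  field
    n      : ℕ
    adj    : Fin n → Fin n → Bool
    sym    : ∀ x y → adj x y ≡ adj y x
    irrefl : ∀ x → adj x x ≡ false

open Graph public

Adj : (G : Graph) → Fin (n G) → Fin (n G) → Set
Adj G x y = adj G x y ≡ true

order : Graph → ℕ
order G = n G

Nontrivial : Graph → Set
Nontrivial G = 2 ≤ n G

data Walk (G : Graph) : Fin (n G) → Fin (n G) → Set where
  here  : ∀ {x} → Walk G x x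
  step  : ∀ {x y z} → Adj G x y → Walk G y z → Walk G x z

Connected : Graph → Set
Connected G = ∀ x y → Walk G x y

nbhd : (G : Graph) → Fin (n G) → Subset (n G)
nbhd G v = tabulate (adj G v)

degree : (G : Graph) → Fin (n G) → ℕ
degree G v = ∣ nbhd G v ∣

Regular : Graph → ℕ → Set
Regular G d = ∀ v → degree G v ≡ d

Independent : (G : Graph) → Subset (n G) → Set
Independent G S = ∀ x y → x ∈ S → y ∈ S → ¬ Adj G x y

MaximalIndependent : (G : Graph) → Subset (n G) → Set
MaximalIndependent G S =
  Independent G S × (∀ T → S ⊆ T → Independent G T → T ⊆ S)

WellCovered : Graph → Set
WellCovered G = ∀ S T → MaximalIndependent G S → MaximalIndependent G T → ∣ S ∣ ≡ ∣ T ∣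

IsIndependenceNumber : Graph → ℕ → Set
IsIndependenceNumber G a =
  (Σ (Subset (n G)) λ S → Independent G S × ∣ S ∣ ≡ a)
  × (∀ S → Independent G S → ∣ S ∣ ≤ a)

InClosedNbhd : (G : Graph) → Fin (n G) → Subset (n G) → Set
InClosedNbhd G x I = x ∈ I ⊎ (Σ (Fin (n G)) λ y → y ∈ I × Adj G x y)

-- x is isolatable: some independent I (possibly empty) such that x is a vertex
-- of G - N[I] with no neighbour in G - N[I]
Isolatable : (G : Graph) → Fin (n G) → Set
Isolatable G x = Σ (Subset (n G)) λ I →
  Independent G I
  × ¬ InClosedNbhd G x I
  × (∀ y → ¬ InClosedNbhd G y I → ¬ Adj G x y)

-- direct (tensor) product G × H, vertex set Fin (n G * n H) identified with
-- Fin (n G) × Fin (n H) via the bijection remQuot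
private
  fstV : (G H : Graph) → Fin (n G * n H) → Fin (n G)
  fstV G H u = proj₁ (remQuot {n G} (n H) u)

  sndV : (G H : Graph) → Fin (n G * n H) → Fin (n H)
  sndV G H u = proj₂ (remQuot {n G} (n H) u)

  prodAdj : (G H : Graph) → Fin (n G * n H) → Fin (n G * n H) → Bool
  prodAdj G H u v = adj G (fstV G H u) (fstV G H v) ∧ adj H (sndV G H u) (sndV G H v)

  prodSym : (G H : Graph) → ∀ u v → prodAdj G H u v ≡ prodAdj G H v u
  prodSym G H u v = cong₂ _∧_ (sym G (fstV G H u) (fstV G H v)) (sym H (sndV G H u) (sndV G H v))

  prodIrr : (G H : Graph) → ∀ u → prodAdj G H u u ≡ false
  prodIrr G H u rewrite irrefl G (fstV G H u) = refl

_×ᴳ_ : Graph → Graph → Graph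
G ×ᴳ H = record
  { n = n G * n H
  ; adj = prodAdj G H
  ; sym = prodSym G H
  ; irrefl = prodIrr G H
  }

-- Fix an independent dominating set J of H; it is nonempty. For A, B ⊆ V(G), the set
-- A × V(H) ∪ B × J is maximal independent in G × H as soon as A is independent, there is no
-- edge between A and B, and every vertex outside A has a neighbour in A or lies in B and has a
-- neighbour in B. This yields three maximal independent sets:
--   V(G) × J, of size n(G)·|J|;
--   {v} × V(H) ∪ (V(G) − N[v]) × J, of size n(H) + (n(G) − 1 − deg v)·|J|, where the layer
--     condition for B = V(G) − N[v] says exactly that no vertex of G − N[v] is isolated in it,
--     i.e. non-isolatability with I = {v};
--   S × V(H) for a maximum independent set S, of size α·n(H).
-- Well-coveredness equates the three sizes, so n(H) = (1 + deg v)·|J| and n(G) = α·(1 + deg v).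
module Submission where

open import Defs renaming (sym to adj-sym; here to stay)
open import Data.Nat using (ℕ; zero; suc; _+_; _*_; _≤_; z≤n; s≤s; >-nonZero)
open import Data.Nat.Properties using (+-suc; +-comm; *-comm; *-assoc; *-distribʳ-+; +-cancelʳ-≡; *-cancelʳ-≡; +-identityʳ; *-identityˡ; ≤-trans; n≮n; m≤m+n)
open import Data.Bool using (true; false; _∧_; _≟_)
open import Data.Bool.Properties using (∧-conicalˡ; ∧-conicalʳ)
open import Data.Fin using (Fin; zero; remQuot; combine; punchIn; fromℕ<)
open import Data.Fin.Properties using (combine-remQuot; remQuot-combine; punchInᵢ≢i; any?)
open import Data.Fin.Subset using (Subset; inside; outside; _∈_; _∉_; _∪_; ∁; ⊤; ⊥; ⁅_⁆; ∣_∣)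
open import Data.Fin.Subset.Properties using (∣⊥∣≡0; ∣⁅x⁆∣≡1; x∈⁅x⁆; x∈⁅y⁆⇒x≡y; _∈?_; x∈p∪q⁻; ∉⊥; ∈⊤; ∣⊤∣≡n; p∪∁p≡⊤; x∈∁p⇒x∉p; x∉p⇒x∈∁p; x∈p⇒x∉∁p; ∣p∣≤n; p⊆q⇒∣p∣≤∣q∣; p⊆p∪q; q⊆p∪q)
open import Data.Vec using ([]; _∷_; _++_; map; concat; lookup; here; there)
open import Data.Vec.Properties using (lookup∘tabulate; map-id; map-const; lookup-map; lookup-concat; []=⇒lookup; lookup⇒[]=)
open import Data.Product using (_×_; _,_; proj₁; proj₂; ∃-syntax)
open import Data.Sum using (_⊎_; inj₁; inj₂)
open import Function using (_∘_; _⇔_; mk⇔; Equivalence)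
open import Relation.Binary.PropositionalEquality
open import Relation.Nullary using (¬_; Dec; yes; no; contradiction; ¬?; _×-dec_; _⊎-dec_)
open import Relation.Nullary.Decidable using (decidable-stable)

private
  variable
    m k : ℕ

∣p∪q∣≡∣p∣+∣q∣ : (p q : Subset m) → (∀ {x} → x ∈ p → x ∉ q) → ∣ p ∪ q ∣ ≡ ∣ p ∣ + ∣ q ∣
∣p∪q∣≡∣p∣+∣q∣ []            []            _        = refl
∣p∪q∣≡∣p∣+∣q∣ (inside  ∷ p) (inside  ∷ q) disjoint = contradiction here (disjoint here)
∣p∪q∣≡∣p∣+∣q∣ (inside  ∷ p) (outside ∷ q) disjoint =
  cong suc (∣p∪q∣≡∣p∣+∣q∣ p q λ x∈p x∈q → disjoint (there x∈p) (there x∈q))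
∣p∪q∣≡∣p∣+∣q∣ (outside ∷ p) (inside  ∷ q) disjoint =
  trans (cong suc (∣p∪q∣≡∣p∣+∣q∣ p q λ x∈p x∈q → disjoint (there x∈p) (there x∈q)))
        (sym (+-suc ∣ p ∣ ∣ q ∣))
∣p∪q∣≡∣p∣+∣q∣ (outside ∷ p) (outside ∷ q) disjoint =
  ∣p∪q∣≡∣p∣+∣q∣ p q λ x∈p x∈q → disjoint (there x∈p) (there x∈q)

∣p∣+∣∁p∣≡n : (p : Subset m) → ∣ p ∣ + ∣ ∁ p ∣ ≡ m
∣p∣+∣∁p∣≡n {m} p = begin
  ∣ p ∣ + ∣ ∁ p ∣ ≡⟨ ∣p∪q∣≡∣p∣+∣q∣ p (∁ p) (λ x∈p x∈∁p → x∈∁p⇒x∉p x∈∁p x∈p) ⟨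
  ∣ p ∪ ∁ p ∣     ≡⟨ cong ∣_∣ (p∪∁p≡⊤ p) ⟩
  ∣ ⊤ {m} ∣       ≡⟨ ∣⊤∣≡n m ⟩
  m               ∎
  where open ≡-Reasoning

∣p++q∣≡∣p∣+∣q∣ : (p : Subset m) (q : Subset k) → ∣ p ++ q ∣ ≡ ∣ p ∣ + ∣ q ∣
∣p++q∣≡∣p∣+∣q∣ []            q = refl
∣p++q∣≡∣p∣+∣q∣ (inside  ∷ p) q = cong suc (∣p++q∣≡∣p∣+∣q∣ p q)
∣p++q∣≡∣p∣+∣q∣ (outside ∷ p) q = ∣p++q∣≡∣p∣+∣q∣ p q

infixr 7 _⊠_

-- Row-major layout: u ∈ S ⊠ T iff remQuot u ∈ S × T, the vertex numbering of G ×ᴳ H.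
_⊠_ : Subset m → Subset k → Subset (m * k)
S ⊠ T = concat (map (λ s → map (s ∧_) T) S)

∣S⊠T∣≡∣S∣*∣T∣ : (S : Subset m) (T : Subset k) → ∣ S ⊠ T ∣ ≡ ∣ S ∣ * ∣ T ∣
∣S⊠T∣≡∣S∣*∣T∣ []            T = refl
∣S⊠T∣≡∣S∣*∣T∣ (inside  ∷ S) T = begin
  ∣ map (true ∧_) T ++ S ⊠ T ∣  ≡⟨ ∣p++q∣≡∣p∣+∣q∣ (map (true ∧_) T) (S ⊠ T) ⟩
  ∣ map (true ∧_) T ∣ + ∣ S ⊠ T ∣ ≡⟨ cong₂ _+_ (cong ∣_∣ (map-id T)) (∣S⊠T∣≡∣S∣*∣T∣ S T) ⟩
  ∣ T ∣ + ∣ S ∣ * ∣ T ∣ ∎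
  where open ≡-Reasoning
∣S⊠T∣≡∣S∣*∣T∣ {k = k} (outside ∷ S) T = begin
  ∣ map (false ∧_) T ++ S ⊠ T ∣  ≡⟨ ∣p++q∣≡∣p∣+∣q∣ (map (false ∧_) T) (S ⊠ T) ⟩
  ∣ map (false ∧_) T ∣ + ∣ S ⊠ T ∣ ≡⟨ cong₂ _+_ (trans (cong ∣_∣ (map-const T false)) (∣⊥∣≡0 k)) (∣S⊠T∣≡∣S∣*∣T∣ S T) ⟩
  ∣ S ∣ * ∣ T ∣ ∎
  where open ≡-Reasoning

lookup-⊠ : (S : Subset m) (T : Subset k) (u : Fin (m * k)) →
  lookup (S ⊠ T) u ≡ lookup S (proj₁ (remQuot {m} k u)) ∧ lookup T (proj₂ (remQuot {m} k u))
lookup-⊠ {m = m} {k = k} S T u = begin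
  lookup (S ⊠ T) u                                  ≡⟨ cong (lookup (S ⊠ T)) (combine-remQuot {m} k u) ⟨
  lookup (S ⊠ T) (combine i j)                      ≡⟨ lookup-concat (map (λ s → map (s ∧_) T) S) i j ⟩
  lookup (lookup (map (λ s → map (s ∧_) T) S) i) j  ≡⟨ cong (λ r → lookup r j) (lookup-map i (λ s → map (s ∧_) T) S) ⟩
  lookup (map (lookup S i ∧_) T) j                  ≡⟨ lookup-map j (lookup S i ∧_) T ⟩
  lookup S i ∧ lookup T j                           ∎
  where
  open ≡-Reasoning
  i = proj₁ (remQuot {m} k u)
  j = proj₂ (remQuot {m} k u)

∈⊠⁺ : (S : Subset m) (T : Subset k) (u : Fin (m * k)) →
  proj₁ (remQuot {m} k u) ∈ S → proj₂ (remQuot {m} k u) ∈ T → u ∈ S ⊠ T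
∈⊠⁺ S T u i∈S j∈T = lookup⇒[]= u (S ⊠ T)
  (trans (lookup-⊠ S T u) (cong₂ _∧_ ([]=⇒lookup i∈S) ([]=⇒lookup j∈T)))

∈⊠⁻ : (S : Subset m) (T : Subset k) (u : Fin (m * k)) → u ∈ S ⊠ T →
  proj₁ (remQuot {m} k u) ∈ S × proj₂ (remQuot {m} k u) ∈ T
∈⊠⁻ S T u u∈S⊠T =
  lookup⇒[]= _ S (∧-conicalˡ _ _ both) , lookup⇒[]= _ T (∧-conicalʳ _ _ both)
  where
  both = trans (sym (lookup-⊠ S T u)) ([]=⇒lookup u∈S⊠T)

x∈p⇒1≤∣p∣ : {x : Fin m} {p : Subset m} → x ∈ p → 1 ≤ ∣ p ∣
x∈p⇒1≤∣p∣ {x = x} {p} x∈p =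
  subst (_≤ ∣ p ∣) (∣⁅x⁆∣≡1 x) (p⊆q⇒∣p∣≤∣q∣ λ y∈⁅x⁆ → subst (_∈ p) (sym (x∈⁅y⁆⇒x≡y x y∈⁅x⁆)) x∈p)

∣p∪⁅x⁆∣≡1+∣p∣ : {p : Subset m} {x : Fin m} → x ∉ p → ∣ p ∪ ⁅ x ⁆ ∣ ≡ suc ∣ p ∣
∣p∪⁅x⁆∣≡1+∣p∣ {p = p} {x} x∉p = begin
  ∣ p ∪ ⁅ x ⁆ ∣     ≡⟨ ∣p∪q∣≡∣p∣+∣q∣ p ⁅ x ⁆ (λ y∈p y∈⁅x⁆ → x∉p (subst (_∈ p) (x∈⁅y⁆⇒x≡y x y∈⁅x⁆) y∈p)) ⟩
  ∣ p ∣ + ∣ ⁅ x ⁆ ∣ ≡⟨ cong (∣ p ∣ +_) (∣⁅x⁆∣≡1 x) ⟩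
  ∣ p ∣ + 1         ≡⟨ +-comm ∣ p ∣ 1 ⟩
  suc ∣ p ∣         ∎
  where open ≡-Reasoning

Dominating : (G : Graph) → Subset (n G) → Set
Dominating G S = ∀ x → x ∉ S → ∃[ y ] y ∈ S × Adj G x y

NoIsolatedVertex : Graph → Set
NoIsolatedVertex G = ∀ x → ∃[ y ] Adj G x y

NoEdgeBetween : (G : Graph) → Subset (n G) → Subset (n G) → Set
NoEdgeBetween G X Y = ∀ x y → x ∈ X → y ∈ Y → ¬ Adj G x y

DominatedInLayers : (G : Graph) → Subset (n G) → Subset (n G) → Set
DominatedInLayers G A B = ∀ g → g ∉ A → (∃[ a ] a ∈ A × Adj G g a) ⊎ (g ∈ B × ∃[ b ] b ∈ B × Adj G g b)

module _ (G : Graph) where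

  Adj? : ∀ x y → Dec (Adj G x y)
  Adj? x y = adj G x y ≟ true

  hasNeighbourIn? : ∀ S x → Dec (∃[ y ] y ∈ S × Adj G x y)
  hasNeighbourIn? S x = any? λ y → y ∈? S ×-dec Adj? x y

  Adj-sym : ∀ {x y} → Adj G x y → Adj G y x
  Adj-sym {x} {y} xy = trans (adj-sym G y x) xy

  Adj-irrefl : ∀ {x} → ¬ Adj G x x
  Adj-irrefl {x} xx with () ← trans (sym xx) (irrefl G x)

  ⊥-independent : Independent G ⊥
  ⊥-independent x _ x∈⊥ = contradiction x∈⊥ ∉⊥

  ⁅x⁆-independent : ∀ x → Independent G ⁅ x ⁆
  ⁅x⁆-independent x y z y∈x z∈x yz
    rewrite x∈⁅y⁆⇒x≡y x y∈x | x∈⁅y⁆⇒x≡y x z∈x = Adj-irrefl yz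

  independent∧dominating⇒maximal : {S : Subset (n G)} →
    Independent G S → Dominating G S → MaximalIndependent G S
  independent∧dominating⇒maximal {S} indS domS = indS , λ T S⊆T indT {x} x∈T →
    decidable-stable (x ∈? S) λ x∉S →
      let (y , y∈S , xy) = domS x x∉S in indT x y x∈T (S⊆T y∈S) xy

  walk⇒neighbour : ∀ {x y} → Walk G x y → x ≢ y → ∃[ z ] Adj G x z
  walk⇒neighbour stay         x≢x = contradiction refl x≢x
  walk⇒neighbour (step xz _) _   = _ , xz

  nontrivial∧connected⇒neighbour : Nontrivial G → Connected G → NoIsolatedVertex G
  nontrivial∧connected⇒neighbour nt conn x =
    let (y , y≢x) = another nt x in walk⇒neighbour (conn x y) (y≢x ∘ sym)
    where
    another : ∀ {m} → 2 ≤ m → (x : Fin m) → ∃[ y ] y ≢ x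
    another (s≤s (s≤s _)) x = punchIn x zero , punchInᵢ≢i x zero

  ∪⁅⁆-independent : {S : Subset (n G)} {x : Fin (n G)} →
    Independent G S → (∀ y → y ∈ S → ¬ Adj G x y) → Independent G (S ∪ ⁅ x ⁆)
  ∪⁅⁆-independent {S} {x} indS x↮S y z y∈ z∈ yz with x∈p∪q⁻ S ⁅ x ⁆ y∈ | x∈p∪q⁻ S ⁅ x ⁆ z∈
  ... | inj₁ y∈S | inj₁ z∈S = indS y z y∈S z∈S yz
  ... | inj₁ y∈S | inj₂ z∈x rewrite x∈⁅y⁆⇒x≡y x z∈x = x↮S y y∈S (Adj-sym yz)
  ... | inj₂ y∈x | inj₁ z∈S rewrite x∈⁅y⁆⇒x≡y x y∈x = x↮S z z∈S yz
  ... | inj₂ y∈x | inj₂ z∈x rewrite x∈⁅y⁆⇒x≡y x y∈x | x∈⁅y⁆⇒x≡y x z∈x = Adj-irrefl yz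

  dominating⇒1≤∣∣ : ∀ {J} → Dominating G J → Fin (n G) → 1 ≤ ∣ J ∣
  dominating⇒1≤∣∣ {J} domJ x with x ∈? J
  ... | yes x∈J = x∈p⇒1≤∣p∣ x∈J
  ... | no x∉J  = x∈p⇒1≤∣p∣ (proj₁ (proj₂ (domJ x x∉J)))

  dominating⊎extendable : (S : Subset (n G)) →
    Dominating G S ⊎ ∃[ x ] x ∉ S × (∀ y → y ∈ S → ¬ Adj G x y)
  dominating⊎extendable S with any? (λ x → ¬? (x ∈? S) ×-dec ¬? (hasNeighbourIn? S x))
  ... | yes (x , x∉S , x↮S) = inj₂ (x , x∉S , λ y y∈S xy → x↮S (y , y∈S , xy))
  ... | no ¬extendable = inj₁ λ x x∉S →
    decidable-stable (hasNeighbourIn? S x) λ x↮S → ¬extendable (x , x∉S , x↮S)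

  maximum⇒dominating : {S : Subset (n G)} →
    Independent G S → (∀ T → Independent G T → ∣ T ∣ ≤ ∣ S ∣) → Dominating G S
  maximum⇒dominating {S} indS maxS with dominating⊎extendable S
  ... | inj₁ domS = domS
  ... | inj₂ (x , x∉S , x↮S) = contradiction
    (subst (_≤ ∣ S ∣) (∣p∪⁅x⁆∣≡1+∣p∣ x∉S) (maxS (S ∪ ⁅ x ⁆) (∪⁅⁆-independent indS x↮S)))
    (n≮n ∣ S ∣)

  ∃-independent-dominating : ∃[ J ] Independent G J × Dominating G J
  ∃-independent-dominating = greedy (n G) ⊥ ⊥-independent (m≤m+n (n G) ∣ ⊥ {n = n G} ∣)
    where
    -- k is fuel: each extension adds a vertex, so n G ≤ k + ∣ S ∣ rules out running dry.
    greedy : ∀ k S → Independent G S → n G ≤ k + ∣ S ∣ → ∃[ J ] Independent G J × Dominating G J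
    greedy k S indS bound with dominating⊎extendable S
    greedy k       S indS bound | inj₁ domS = S , indS , domS
    greedy zero    S indS bound | inj₂ (x , x∉S , _) = contradiction
      (≤-trans (subst (_≤ n G) (∣p∪⁅x⁆∣≡1+∣p∣ x∉S) (∣p∣≤n (S ∪ ⁅ x ⁆))) bound)
      (n≮n ∣ S ∣)
    greedy (suc k) S indS bound | inj₂ (x , x∉S , x↮S) =
      greedy k (S ∪ ⁅ x ⁆) (∪⁅⁆-independent indS x↮S)
        (subst (n G ≤_) (trans (sym (+-suc k ∣ S ∣)) (cong (k +_) (sym (∣p∪⁅x⁆∣≡1+∣p∣ x∉S)))) bound)

  ¬isolatable⇒neighbour-outside : ∀ {x I} → ¬ Isolatable G x → Independent G I → ¬ InClosedNbhd G x I →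
    ∃[ y ] ¬ InClosedNbhd G y I × Adj G x y
  ¬isolatable⇒neighbour-outside {x} {I} ¬iso indI x∉N[I] =
    decidable-stable (any? λ y → ¬? (InClosedNbhd? y) ×-dec Adj? x y) λ none →
      ¬iso (I , indI , x∉N[I] , λ y y∉N[I] xy → none (y , y∉N[I] , xy))
    where
    InClosedNbhd? : ∀ y → Dec (InClosedNbhd G y I)
    InClosedNbhd? y = y ∈? I ⊎-dec hasNeighbourIn? I y

  closedNbhd : Fin (n G) → Subset (n G)
  closedNbhd v = ⁅ v ⁆ ∪ nbhd G v

  ∈nbhd⇔Adj : ∀ {v x} → x ∈ nbhd G v ⇔ Adj G v x
  ∈nbhd⇔Adj {v} {x} = mk⇔
    (λ x∈N → trans (sym (lookup∘tabulate (adj G v) x)) ([]=⇒lookup x∈N))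
    (λ vx → lookup⇒[]= x (nbhd G v) (trans (lookup∘tabulate (adj G v) x) vx))

  ∈closedNbhd⇔InClosedNbhd : ∀ {v x} → x ∈ closedNbhd v ⇔ InClosedNbhd G x ⁅ v ⁆
  ∈closedNbhd⇔InClosedNbhd {v} {x} = mk⇔ to from
    where
    to : x ∈ closedNbhd v → InClosedNbhd G x ⁅ v ⁆
    to x∈N with x∈p∪q⁻ ⁅ v ⁆ (nbhd G v) x∈N
    ... | inj₁ x∈v = inj₁ x∈v
    ... | inj₂ x∈Nv = inj₂ (v , x∈⁅x⁆ v , Adj-sym (Equivalence.to ∈nbhd⇔Adj x∈Nv))
    from : InClosedNbhd G x ⁅ v ⁆ → x ∈ closedNbhd v
    from (inj₁ x∈v) = p⊆p∪q (nbhd G v) x∈v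
    from (inj₂ (y , y∈v , xy)) rewrite x∈⁅y⁆⇒x≡y v y∈v =
      q⊆p∪q ⁅ v ⁆ (nbhd G v) (Equivalence.from ∈nbhd⇔Adj (Adj-sym xy))

  ∣closedNbhd∣≡1+degree : ∀ v → ∣ closedNbhd v ∣ ≡ suc (degree G v)
  ∣closedNbhd∣≡1+degree v = begin
    ∣ ⁅ v ⁆ ∪ nbhd G v ∣       ≡⟨ ∣p∪q∣≡∣p∣+∣q∣ ⁅ v ⁆ (nbhd G v) v∉N ⟩
    ∣ ⁅ v ⁆ ∣ + ∣ nbhd G v ∣   ≡⟨ cong (_+ degree G v) (∣⁅x⁆∣≡1 v) ⟩
    suc (degree G v)          ∎
    where
    open ≡-Reasoning
    v∉N : ∀ {x} → x ∈ ⁅ v ⁆ → x ∉ nbhd G v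
    v∉N x∈v x∈N rewrite x∈⁅y⁆⇒x≡y v x∈v = Adj-irrefl (Equivalence.to ∈nbhd⇔Adj x∈N)

module _ (G H : Graph) where

  private
    π₁ : Fin (n G * n H) → Fin (n G)
    π₁ u = proj₁ (remQuot {n G} (n H) u)

    π₂ : Fin (n G * n H) → Fin (n H)
    π₂ u = proj₂ (remQuot {n G} (n H) u)

  Adj-×ᴳ⁻ : ∀ {u w} → Adj (G ×ᴳ H) u w → Adj G (π₁ u) (π₁ w) × Adj H (π₂ u) (π₂ w)
  Adj-×ᴳ⁻ uw = ∧-conicalˡ _ _ uw , ∧-conicalʳ _ _ uw

  module _ (A B : Subset (n G)) (J : Subset (n H)) where

    layered : Subset (n G * n H)
    layered = A ⊠ ⊤ ∪ B ⊠ J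

    InLayers : Fin (n G) → Fin (n H) → Set
    InLayers g h = g ∈ A ⊎ (g ∈ B × h ∈ J)

    ∈layered⁺ : ∀ u → InLayers (π₁ u) (π₂ u) → u ∈ layered
    ∈layered⁺ u (inj₁ g∈A) = p⊆p∪q (B ⊠ J) (∈⊠⁺ A ⊤ u g∈A ∈⊤)
    ∈layered⁺ u (inj₂ (g∈B , h∈J)) = q⊆p∪q (A ⊠ ⊤) (B ⊠ J) (∈⊠⁺ B J u g∈B h∈J)

    ∈layered⁻ : ∀ u → u ∈ layered → InLayers (π₁ u) (π₂ u)
    ∈layered⁻ u u∈ with x∈p∪q⁻ (A ⊠ ⊤) (B ⊠ J) u∈
    ... | inj₁ u∈A⊠⊤ = inj₁ (proj₁ (∈⊠⁻ A ⊤ u u∈A⊠⊤))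
    ... | inj₂ u∈B⊠J = inj₂ (∈⊠⁻ B J u u∈B⊠J)

    layered-neighbour : ∀ u g h → InLayers g h → Adj G (π₁ u) g → Adj H (π₂ u) h →
      ∃[ w ] w ∈ layered × Adj (G ×ᴳ H) u w
    layered-neighbour u g h gh∈ ug uh =
      combine g h , ∈layered⁺ (combine g h) (proj₁ transported) , proj₂ transported
      where
      transported = subst (λ (g′ , h′) → InLayers g′ h′ × adj G (π₁ u) g′ ∧ adj H (π₂ u) h′ ≡ true)
                          (sym (remQuot-combine {n G} {n H} g h)) (gh∈ , cong₂ _∧_ ug uh)

    layered-independent : Independent G A → NoEdgeBetween G B A →
      Independent H J → Independent (G ×ᴳ H) layered
    layered-independent indA B↮A indJ u w u∈ w∈ uw with ∈layered⁻ u u∈ | ∈layered⁻ w w∈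
    ... | inj₁ g∈A       | inj₁ g′∈A        = indA _ _ g∈A g′∈A (proj₁ (Adj-×ᴳ⁻ uw))
    ... | inj₁ g∈A       | inj₂ (g′∈B , _)  = B↮A _ _ g′∈B g∈A (Adj-sym G (proj₁ (Adj-×ᴳ⁻ uw)))
    ... | inj₂ (g∈B , _) | inj₁ g′∈A        = B↮A _ _ g∈B g′∈A (proj₁ (Adj-×ᴳ⁻ uw))
    ... | inj₂ (_ , h∈J) | inj₂ (_ , h′∈J)  = indJ _ _ h∈J h′∈J (proj₂ (Adj-×ᴳ⁻ uw))

    layered-dominating : Dominating H J → NoIsolatedVertex H →
      DominatedInLayers G A B →
      Dominating (G ×ᴳ H) layered
    layered-dominating domJ nbH domG u u∉ with π₁ u ∈? A
    ... | yes g∈A = contradiction (∈layered⁺ u (inj₁ g∈A)) u∉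
    ... | no g∉A with domG (π₁ u) g∉A
    ...   | inj₁ (a , a∈A , ga) = let (h′ , hh′) = nbH (π₂ u) in
      layered-neighbour u a h′ (inj₁ a∈A) ga hh′
    ...   | inj₂ (g∈B , b , b∈B , gb) with π₂ u ∈? J
    ...     | yes h∈J = contradiction (∈layered⁺ u (inj₂ (g∈B , h∈J))) u∉
    ...     | no h∉J = let (h′ , h′∈J , hh′) = domJ (π₂ u) h∉J in
      layered-neighbour u b h′ (inj₂ (b∈B , h′∈J)) gb hh′

    ∣layered∣ : (∀ {x} → x ∈ A → x ∉ B) → ∣ layered ∣ ≡ ∣ A ∣ * n H + ∣ B ∣ * ∣ J ∣
    ∣layered∣ A∩B=∅ = begin
      ∣ A ⊠ ⊤ ∪ B ⊠ J ∣           ≡⟨ ∣p∪q∣≡∣p∣+∣q∣ (A ⊠ ⊤) (B ⊠ J) disjoint ⟩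
      ∣ A ⊠ ⊤ ∣ + ∣ B ⊠ J ∣       ≡⟨ cong₂ _+_ (∣S⊠T∣≡∣S∣*∣T∣ A ⊤) (∣S⊠T∣≡∣S∣*∣T∣ B J) ⟩
      ∣ A ∣ * ∣ ⊤ {n H} ∣ + ∣ B ∣ * ∣ J ∣ ≡⟨ cong (λ k → ∣ A ∣ * k + ∣ B ∣ * ∣ J ∣) (∣⊤∣≡n (n H)) ⟩
      ∣ A ∣ * n H + ∣ B ∣ * ∣ J ∣   ∎
      where
      open ≡-Reasoning
      disjoint : ∀ {u} → u ∈ A ⊠ ⊤ → u ∉ B ⊠ J
      disjoint {u} u∈A⊠⊤ u∈B⊠J = A∩B=∅ (proj₁ (∈⊠⁻ A ⊤ u u∈A⊠⊤)) (proj₁ (∈⊠⁻ B J u u∈B⊠J))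

    layered-maximal : Independent G A → NoEdgeBetween G B A →
      Independent H J → Dominating H J → NoIsolatedVertex H →
      DominatedInLayers G A B →
      MaximalIndependent (G ×ᴳ H) layered
    layered-maximal indA B↮A indJ domJ nbH domG = independent∧dominating⇒maximal (G ×ᴳ H)
      (layered-independent indA B↮A indJ) (layered-dominating domJ nbH domG)

MaximalIndependentOfSize : Graph → ℕ → Set
MaximalIndependentOfSize G s = ∃[ S ] MaximalIndependent G S × ∣ S ∣ ≡ s

wellCovered⇒sizes-equal : ∀ {G s t} → WellCovered G →
  MaximalIndependentOfSize G s → MaximalIndependentOfSize G t → s ≡ t
wellCovered⇒sizes-equal wc (S , maxS , ∣S∣≡s) (T , maxT , ∣T∣≡t) =
  trans (sym ∣S∣≡s) (trans (wc S T maxS maxT) ∣T∣≡t)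

module _ (G H : Graph) {J : Subset (n H)}
  (indJ : Independent H J) (domJ : Dominating H J) (nbH : NoIsolatedVertex H) where

  whole-layer : NoIsolatedVertex G → MaximalIndependentOfSize (G ×ᴳ H) (n G * ∣ J ∣)
  whole-layer nbG = layered G H ⊥ ⊤ J
    , layered-maximal G H ⊥ ⊤ J (⊥-independent G) (λ _ _ _ y∈⊥ → contradiction y∈⊥ ∉⊥)
        indJ domJ nbH (λ g _ → let (g′ , gg′) = nbG g in inj₂ (∈⊤ , g′ , ∈⊤ , gg′))
    , trans (∣layered∣ G H ⊥ ⊤ J λ x∈⊥ → contradiction x∈⊥ ∉⊥)
            (cong₂ (λ a b → a * n H + b * ∣ J ∣) (∣⊥∣≡0 (n G)) (∣⊤∣≡n (n G)))

  maximum-layer : ∀ {S} → Independent G S → (∀ T → Independent G T → ∣ T ∣ ≤ ∣ S ∣) →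
    MaximalIndependentOfSize (G ×ᴳ H) (∣ S ∣ * n H)
  maximum-layer {S} indS maxS = layered G H S ⊥ J
    , layered-maximal G H S ⊥ J indS (λ _ _ x∈⊥ → contradiction x∈⊥ ∉⊥) indJ domJ nbH
        (λ g g∉S → inj₁ (maximum⇒dominating G indS maxS g g∉S))
    , trans (∣layered∣ G H S ⊥ J λ _ → ∉⊥)
            (trans (cong (λ b → ∣ S ∣ * n H + b * ∣ J ∣) (∣⊥∣≡0 (n G))) (+-identityʳ _))

  star-layer : (∀ x → ¬ Isolatable G x) → ∀ v →
    MaximalIndependentOfSize (G ×ᴳ H) (n H + ∣ ∁ (closedNbhd G v) ∣ * ∣ J ∣)
  star-layer ¬iso v = layered G H ⁅ v ⁆ (∁ N[v]) J
    , layered-maximal G H ⁅ v ⁆ (∁ N[v]) J (⁅x⁆-independent G v) outside↮v indJ domJ nbH dom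
    , trans (∣layered∣ G H ⁅ v ⁆ (∁ N[v]) J λ x∈v → x∈p⇒x∉∁p (p⊆p∪q (nbhd G v) x∈v))
            (trans (cong (λ a → a * n H + ∣ ∁ N[v] ∣ * ∣ J ∣) (∣⁅x⁆∣≡1 v))
                   (cong (_+ ∣ ∁ N[v] ∣ * ∣ J ∣) (*-identityˡ (n H))))
    where
    N[v] = closedNbhd G v
    in-N[v] : ∀ {x} → InClosedNbhd G x ⁅ v ⁆ → x ∈ N[v]
    in-N[v] = Equivalence.from (∈closedNbhd⇔InClosedNbhd G)
    outside↮v : NoEdgeBetween G (∁ N[v]) ⁅ v ⁆
    outside↮v x y x∉N y∈v xy = x∈∁p⇒x∉p x∉N (in-N[v] (inj₂ (y , y∈v , xy)))
    dom : DominatedInLayers G ⁅ v ⁆ (∁ N[v])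
    dom g g∉v with g ∈? N[v]
    ... | yes g∈N with Equivalence.to (∈closedNbhd⇔InClosedNbhd G) g∈N
    ...   | inj₁ g∈v = contradiction g∈v g∉v
    ...   | inj₂ nb = inj₁ nb
    dom g g∉v | no g∉N =
      let (y , y∉N , gy) = ¬isolatable⇒neighbour-outside G (¬iso g) (⁅x⁆-independent G v) (g∉N ∘ in-N[v])
      in inj₂ (x∉p⇒x∈∁p g∉N , y , x∉p⇒x∈∁p (y∉N ∘ Equivalence.to (∈closedNbhd⇔InClosedNbhd G)) , gy)

regularity-arithmetic : ∀ {nG nH j d c α} → 1 ≤ j → suc d + c ≡ nG →
  nG * j ≡ nH + c * j → nG * j ≡ α * nH → suc d * α ≡ nG
regularity-arithmetic {nG} {nH} {j} {d} {c} {α} 1≤j N[v]⊎rest whole≡star whole≡maximum =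
  *-cancelʳ-≡ (suc d * α) nG j {{>-nonZero 1≤j}} (begin
    suc d * α * j   ≡⟨ cong (_* j) (*-comm (suc d) α) ⟩
    α * suc d * j   ≡⟨ *-assoc α (suc d) j ⟩
    α * (suc d * j) ≡⟨ cong (α *_) nH≡[1+d]j ⟨
    α * nH          ≡⟨ whole≡maximum ⟨
    nG * j          ∎)
  where
  open ≡-Reasoning
  nH≡[1+d]j : nH ≡ suc d * j
  nH≡[1+d]j = +-cancelʳ-≡ (c * j) nH (suc d * j) (begin
    nH + c * j          ≡⟨ whole≡star ⟨
    nG * j              ≡⟨ cong (_* j) N[v]⊎rest ⟨
    (suc d + c) * j     ≡⟨ *-distribʳ-+ j (suc d) c ⟩
    suc d * j + c * j   ∎)

corollary4p2 : (G H : Graph) → Nontrivial G → Nontrivial H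
    → Connected G → Connected H
    → (∀ x → ¬ Isolatable G x)
    → WellCovered (G ×ᴳ H)
    → (α : ℕ) → IsIndependenceNumber G α
    → ∀ v → suc (degree G v) * α ≡ order G
corollary4p2 G H ntG ntH connG connH ¬iso wc α ((S , indS , ∣S∣≡α) , α-max) v
  with ∃-independent-dominating H
... | J , indJ , domJ = regularity-arithmetic {d = degree G v} {α = α}
  (dominating⇒1≤∣∣ H domJ (fromℕ< {0} (≤-trans (s≤s z≤n) ntH)))
  (subst (λ k → k + ∣ ∁ (closedNbhd G v) ∣ ≡ n G) (∣closedNbhd∣≡1+degree G v) (∣p∣+∣∁p∣≡n (closedNbhd G v)))
  (same-size whole (star-layer G H indJ domJ nbH ¬iso v))
  (trans (same-size whole (maximum-layer G H indJ domJ nbH indS S-maximum))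
         (cong (_* n H) ∣S∣≡α))
  where
  same-size : ∀ {s t} → MaximalIndependentOfSize (G ×ᴳ H) s → MaximalIndependentOfSize (G ×ᴳ H) t → s ≡ t
  same-size = wellCovered⇒sizes-equal {G ×ᴳ H} wc
  nbH : NoIsolatedVertex H
  nbH = nontrivial∧connected⇒neighbour H ntH connH
  whole : MaximalIndependentOfSize (G ×ᴳ H) (n G * ∣ J ∣)
  whole = whole-layer G H indJ domJ nbH (nontrivial∧connected⇒neighbour G ntG connG)
  S-maximum : ∀ T → Independent G T → ∣ T ∣ ≤ ∣ S ∣
  S-maximum T indT = subst (∣ T ∣ ≤_) (sym ∣S∣≡α) (α-max T indT)
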